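{- Let $\mathcal{D}$ be an integral domain of characteristic $0$ with field of fractions $\mathcal{K}$, and let $\Phi(U)=\sum_{n=0}^\infty\frac{\beta_n}{n!}U^n$ with $\beta_n\in\mathcal{D}$ for all $n$. Then $\Phi$ is $u$-integral if and only if $$\frac{1}{d!}\big(c_{d,1}\beta_1+c_{d,2}\beta_2+\cdots+c_{d,d}\beta_d\big)\in\mathcal{D}\quad\text{for all } d=1,2,\dots,$$ where the integers $c_{d,r}$ are defined by $X(X-1)\cdots(X-d+1)=\sum_{r=0}^dc_{d,r}X^r$.
   Context: A power series $\Phi(U)\in\mathcal{K}[[U]]$ is called $u$-integral if $\Phi(U)=F(e^U-1)$ for some $F(u)\in\mathcal{D}[[u]]$, where $e^U-1=U+U^2/2!+U^3/3!+\cdots$. -}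

module Defs where

open import Level using (Level; _⊔_) renaming (suc to lsuc)
open import Data.Nat using (ℕ; zero; suc; _∸_; _!; NonZero)
open import Data.Nat.Properties using (_!≢0)
open import Data.Integer as ℤ using (ℤ; +_; -[1+_])
open import Data.Product using (Σ; _×_; _,_; ∃)
open import Data.Sum using (_⊎_)
open import Relation.Nullary using (¬_)
open import Relation.Binary.PropositionalEquality using (_≡_)
open import Algebra.Bundles using (CommutativeRing)
open import Algebra.Morphism.Structures using (module RingMorphisms)

module _ {c ℓ : Level} (R : CommutativeRing c ℓ) where
  open CommutativeRing R hiding (zero)

  fromℕ : ℕ → Carrier
  fromℕ zero    = 0#
  fromℕ (suc n) = 1# + fromℕ n

  fromℤ : ℤ → Carrier
  fromℤ (+ n)     = fromℕ n
  fromℤ -[1+ n ]  = - fromℕ (suc n)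

  sumTo : ℕ → (ℕ → Carrier) → Carrier
  sumTo zero    f = f zero
  sumTo (suc n) f = sumTo n f + f (suc n)

  sum1To : ℕ → (ℕ → Carrier) → Carrier
  sum1To zero    f = 0#
  sum1To (suc n) f = sum1To n f + f (suc n)

  PowerSeries : Set c
  PowerSeries = ℕ → Carrier

  _≈ₚ_ : PowerSeries → PowerSeries → Set ℓ
  F ≈ₚ G = ∀ n → F n ≈ G n

  _*ₚ_ : PowerSeries → PowerSeries → PowerSeries
  (F *ₚ G) n = sumTo n (λ i → F i * G (n ∸ i))

  oneₚ : PowerSeries
  oneₚ zero    = 1#
  oneₚ (suc n) = 0#

  _^ₚ_ : PowerSeries → ℕ → PowerSeries
  F ^ₚ zero  = oneₚ
  F ^ₚ suc k = F *ₚ (F ^ₚ k)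

  -- composition F(G) for G with zero constant term:
  -- [U^n] F(G(U)) = Σ_{k=0}^{n} f_k [U^n] G^k   (terms k > n vanish)
  compose : PowerSeries → PowerSeries → PowerSeries
  compose F G n = sumTo n (λ k → F k * (G ^ₚ k) n)

record IsIntegralDomain {c ℓ : Level} (D : CommutativeRing c ℓ) : Set (c ⊔ ℓ) where
  open CommutativeRing D hiding (zero)
  field
    1≉0            : ¬ (1# ≈ 0#)
    noZeroDivisors : ∀ x y → (x * y) ≈ 0# → (x ≈ 0#) ⊎ (y ≈ 0#)

HasCharacteristicZero : {c ℓ : Level} (D : CommutativeRing c ℓ) → Set ℓ
HasCharacteristicZero D = ∀ n → ¬ (fromℕ D (suc n) ≈ 0#)
  where open CommutativeRing D hiding (zero)

record FieldOfFractions {c ℓ : Level} (D : CommutativeRing c ℓ) (c' ℓ' : Level)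
       : Set (lsuc (c' ⊔ ℓ') ⊔ c ⊔ ℓ) where
  field
    K : CommutativeRing c' ℓ'
  open CommutativeRing K hiding (zero)
  module D = CommutativeRing D
  open RingMorphisms D.rawRing rawRing
  field
    ι            : D.Carrier → Carrier
    ι-mono       : IsRingMonomorphism ι
    inv          : (x : Carrier) → ¬ (x ≈ 0#) → Carrier
    inv-law      : ∀ x (p : ¬ (x ≈ 0#)) → (x * inv x p) ≈ 1#
    1≉0          : ¬ (1# ≈ 0#)
    isFraction   : ∀ (k : Carrier) → Σ D.Carrier λ a → Σ D.Carrier λ b →
                     (¬ (b D.≈ D.0#)) × ((k * ι b) ≈ ι a)

module Setting {c ℓ c' ℓ' : Level} (D : CommutativeRing c ℓ)
               (char0 : HasCharacteristicZero D)
               (Frac : FieldOfFractions D c' ℓ') where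
  open FieldOfFractions Frac
  open CommutativeRing K hiding (zero)
  open RingMorphisms D.rawRing rawRing
  open IsRingMonomorphism ι-mono

  -- n! in K is nonzero (characteristic 0 and ι injective)
  fact-nonzero : ∀ n → ¬ (ι (fromℕ D (n !)) ≈ 0#)
  fact-nonzero n eq = helper (n !) {{n !≢0}}
    (injective (trans eq (sym 0#-homo)))
    where
    helper : ∀ m → {{NonZero m}} → ¬ (fromℕ D m D.≈ D.0#)
    helper (suc m) = char0 m

  invFact : ℕ → Carrier
  invFact n = inv (ι (fromℕ D (n !))) (fact-nonzero n)

  ιₚ : PowerSeries D → PowerSeries K
  ιₚ F n = ι (F n)

  expMinusOne : PowerSeries K
  expMinusOne zero    = 0#
  expMinusOne (suc n) = invFact (suc n)

  IsUIntegral : PowerSeries K → Set (c ⊔ ℓ')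
  IsUIntegral Φ = Σ (PowerSeries D) λ F → _≈ₚ_ K Φ (compose K (ιₚ F) expMinusOne)

  egf : (ℕ → D.Carrier) → PowerSeries K
  egf β n = ι (β n) * invFact n

  InD : Carrier → Set (c ⊔ ℓ')
  InD k = Σ D.Carrier λ a → ι a ≈ k

-- Coefficients c_{d,r} of X(X−1)⋯(X−d+1) = Σ_{r=0}^{d} c_{d,r} X^r,
-- computed by expanding the product one factor at a time:
-- X(X−1)⋯(X−d) = (Σ_r c_{d,r} X^r)(X − d).

stirlingCoeff : ℕ → ℕ → ℤ
stirlingCoeff zero    zero    = + 1
stirlingCoeff zero    (suc r) = + 0
stirlingCoeff (suc d) zero    = ℤ.- ((+ d) ℤ.* stirlingCoeff d zero)
stirlingCoeff (suc d) (suc r) =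
  stirlingCoeff d r ℤ.- ((+ d) ℤ.* stirlingCoeff d (suc r))

open Setting public

{-# OPTIONS --safe #-}
-- Write F(u) = Σ f_k u^k. Since n! [U^n] (e^U − 1)^k is the number surj(n,k) = k! S(n,k) of surjections
-- from an n-set onto a k-set, Φ = F(e^U − 1) says exactly that β_n = Σ_k surj(n,k) f_k for all n.
-- The Stirling numbers of the two kinds are inverse to each other, Σ_r c_{d,r} surj(r,k) = d! δ_{dk},
-- and c_{d,d} = 1, so this triangular system is equivalent to Σ_r c_{d,r} β_r = d! f_d for all d.
-- Hence a solution F ∈ D[[u]] exists iff every (1/d!) Σ_r c_{d,r} β_r lies in D (take f_0 = β_0);
-- everything is computed in K, where d! is invertible.
module Submission where

open import Defs
open import Data.Nat using (ℕ; suc)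
open import Function.Bundles using (_⇔_)
open import Algebra.Bundles using (CommutativeRing)

open import Level using (Level)
open import Data.Nat as ℕ using (zero; _∸_; _≤_; _<_; _≤′_; ≤′-refl; ≤′-step; z≤n; s≤s; _!)
import Data.Nat.Properties as ℕₚ
open import Data.Integer as ℤ using (+_; -[1+_])
import Data.Integer.Properties as ℤₚ
open import Data.Integer.Tactic.RingSolver using (solve-∀)
open import Data.Product using (_,_; proj₁; proj₂)
open import Data.Sum using (inj₁; inj₂)
open import Data.Empty using (⊥-elim)
open import Function.Base using (_∘_)
open import Function.Bundles using (mk⇔; Equivalence)
open import Relation.Nullary using (yes; no)
import Relation.Binary.PropositionalEquality as ≡
open ≡ using (_≡_; _≢_)
open import Algebra.Morphism.Structures using (module RingMorphisms)

stirlingCoeff-above : ∀ {d r} → d < r → stirlingCoeff d r ≡ + 0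
stirlingCoeff-above {zero}  {suc r} _ = ≡.refl
stirlingCoeff-above {suc d} {suc r} (s≤s d<r)
  rewrite stirlingCoeff-above d<r | stirlingCoeff-above (ℕₚ.m<n⇒m<1+n d<r)
        | ℤₚ.*-zeroʳ (+ d) = ≡.refl

stirlingCoeff-diagonal : ∀ d → stirlingCoeff d d ≡ + 1
stirlingCoeff-diagonal zero = ≡.refl
stirlingCoeff-diagonal (suc d)
  rewrite stirlingCoeff-diagonal d | stirlingCoeff-above (ℕₚ.n<1+n d)
        | ℤₚ.*-zeroʳ (+ d) = ≡.refl

stirlingCoeff-suc-zero : ∀ d → stirlingCoeff (suc d) 0 ≡ + 0
stirlingCoeff-suc-zero zero = ≡.refl
stirlingCoeff-suc-zero (suc d) rewrite stirlingCoeff-suc-zero d | ℤₚ.*-zeroʳ (+ suc d) = ≡.refl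

stirlingCoeff-rec-zero : ∀ d → stirlingCoeff (suc d) 0 ℤ.+ + d ℤ.* stirlingCoeff d 0 ≡ + 0
stirlingCoeff-rec-zero d = ℤₚ.+-inverseˡ (+ d ℤ.* stirlingCoeff d 0)

stirlingCoeff-rec-suc : ∀ d r →
  stirlingCoeff (suc d) (suc r) ℤ.+ + d ℤ.* stirlingCoeff d (suc r) ≡ stirlingCoeff d r
stirlingCoeff-rec-suc d r = sub-add (stirlingCoeff d r) (+ d ℤ.* stirlingCoeff d (suc r))
  where
  sub-add : ∀ x y → x ℤ.- y ℤ.+ y ≡ x
  sub-add = solve-∀

surjections : ℕ → ℕ → ℕ
surjections zero    zero    = 1
surjections zero    (suc k) = 0
surjections (suc n) zero    = 0
surjections (suc n) (suc k) = suc k ℕ.* (surjections n (suc k) ℕ.+ surjections n k)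

surjections-below : ∀ {n k} → n < k → surjections n k ≡ 0
surjections-below {zero}  {suc k} _ = ≡.refl
surjections-below {suc n} {suc k} (s≤s n<k)
  rewrite surjections-below n<k | surjections-below (ℕₚ.m<n⇒m<1+n n<k)
  = ℕₚ.*-zeroʳ (suc k)

module RingProperties {c ℓ : Level} (R : CommutativeRing c ℓ) where
  open CommutativeRing R hiding (zero)
  open import Relation.Binary.Reasoning.Setoid setoid
  open import Algebra.Properties.Ring ring using (-‿+-comm; -0#≈0#)
  open import Algebra.Properties.Semiring.Mult semiring using (_×_; ×-homo-+; ×1-homo-*)

  fromℕ≈×1# : ∀ n → fromℕ R n ≈ n × 1#
  fromℕ≈×1# zero    = refl
  fromℕ≈×1# (suc n) = +-congˡ (fromℕ≈×1# n)

  fromℕ-+ : ∀ m n → fromℕ R (m ℕ.+ n) ≈ fromℕ R m + fromℕ R n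
  fromℕ-+ m n = begin
    fromℕ R (m ℕ.+ n)           ≈⟨ fromℕ≈×1# (m ℕ.+ n) ⟩
    (m ℕ.+ n) × 1#              ≈⟨ ×-homo-+ 1# m n ⟩
    m × 1# + n × 1#           ≈⟨ +-cong (fromℕ≈×1# m) (fromℕ≈×1# n) ⟨
    fromℕ R m + fromℕ R n     ∎

  fromℕ-* : ∀ m n → fromℕ R (m ℕ.* n) ≈ fromℕ R m * fromℕ R n
  fromℕ-* m n = begin
    fromℕ R (m ℕ.* n)           ≈⟨ fromℕ≈×1# (m ℕ.* n) ⟩
    (m ℕ.* n) × 1#              ≈⟨ ×1-homo-* m n ⟩
    m × 1# * n × 1#           ≈⟨ *-cong (fromℕ≈×1# m) (fromℕ≈×1# n) ⟨
    fromℕ R m * fromℕ R n     ∎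

  fromℤ-⊖ : ∀ m n → fromℤ R (m ℤ.⊖ n) ≈ fromℕ R m - fromℕ R n
  fromℤ-⊖ zero    zero    = sym (-‿inverseʳ 0#)
  fromℤ-⊖ (suc m) zero    = sym (trans (+-congˡ -0#≈0#) (+-identityʳ _))
  fromℤ-⊖ zero    (suc n) = sym (+-identityˡ _)
  fromℤ-⊖ (suc m) (suc n) rewrite ℤₚ.[1+m]⊖[1+n]≡m⊖n m n = begin
    fromℤ R (m ℤ.⊖ n)                       ≈⟨ fromℤ-⊖ m n ⟩
    fromℕ R m - fromℕ R n                   ≈⟨ +-congʳ (+-identityˡ _) ⟨
    (0# + fromℕ R m) - fromℕ R n            ≈⟨ +-congʳ (+-congʳ (-‿inverseʳ 1#)) ⟨
    ((1# - 1#) + fromℕ R m) - fromℕ R n     ≈⟨ shift 1# (fromℕ R m) (fromℕ R n) ⟩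
    (1# + fromℕ R m) - (1# + fromℕ R n)     ∎
    where
    shift : ∀ u x y → ((u - u) + x) - y ≈ (u + x) - (u + y)
    shift u x y = begin
      ((u - u) + x) - y       ≈⟨ +-congʳ (+-assoc u (- u) x) ⟩
      (u + (- u + x)) - y     ≈⟨ +-congʳ (+-congˡ (+-comm (- u) x)) ⟩
      (u + (x - u)) - y       ≈⟨ +-congʳ (+-assoc u x (- u)) ⟨
      ((u + x) - u) - y       ≈⟨ +-assoc (u + x) (- u) (- y) ⟩
      (u + x) + (- u - y)     ≈⟨ +-congˡ (-‿+-comm u y) ⟩
      (u + x) - (u + y)       ∎

  fromℤ-+ : ∀ x y → fromℤ R (x ℤ.+ y) ≈ fromℤ R x + fromℤ R y
  fromℤ-+ (+ m)    (+ n)    = fromℕ-+ m n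
  fromℤ-+ (+ m)    -[1+ n ] = fromℤ-⊖ m (suc n)
  fromℤ-+ -[1+ m ] (+ n)    = trans (fromℤ-⊖ n (suc m)) (+-comm _ _)
  fromℤ-+ -[1+ m ] -[1+ n ] = begin
    - fromℕ R (suc (suc (m ℕ.+ n)))        ≡⟨ ≡.cong (λ t → - fromℕ R (suc t)) (ℕₚ.+-suc m n) ⟨
    - fromℕ R (suc m ℕ.+ suc n)            ≈⟨ -‿cong (fromℕ-+ (suc m) (suc n)) ⟩
    - (fromℕ R (suc m) + fromℕ R (suc n))  ≈⟨ -‿+-comm _ _ ⟨
    - fromℕ R (suc m) - fromℕ R (suc n)    ∎

  fromℤ-*-fromℕ : ∀ d z → fromℤ R (+ d ℤ.* z) ≈ fromℕ R d * fromℤ R z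
  fromℤ-*-fromℕ zero    z = trans (reflexive (≡.cong (fromℤ R) (ℤₚ.*-zeroˡ z))) (sym (zeroˡ _))
  fromℤ-*-fromℕ (suc d) z = begin
    fromℤ R (+ suc d ℤ.* z)                   ≡⟨ ≡.cong (fromℤ R) (ℤₚ.suc-* (+ d) z) ⟩
    fromℤ R (z ℤ.+ + d ℤ.* z)                 ≈⟨ fromℤ-+ z (+ d ℤ.* z) ⟩
    fromℤ R z + fromℤ R (+ d ℤ.* z)           ≈⟨ +-cong (sym (*-identityˡ _)) (fromℤ-*-fromℕ d z) ⟩
    1# * fromℤ R z + fromℕ R d * fromℤ R z    ≈⟨ distribʳ _ _ _ ⟨
    (1# + fromℕ R d) * fromℤ R z              ∎

  fromℤ-+-fromℕ-* : ∀ x d y → fromℤ R (x ℤ.+ + d ℤ.* y) ≈ fromℤ R x + fromℕ R d * fromℤ R y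
  fromℤ-+-fromℕ-* x d y = trans (fromℤ-+ x (+ d ℤ.* y)) (+-congˡ (fromℤ-*-fromℕ d y))

  *-inverse-shift : ∀ {a b} → a * b ≈ 1# → ∀ x y → (b * x ≈ y ⇔ x ≈ a * y)
  *-inverse-shift {a} {b} ab≈1 x y = mk⇔ to from
    where
    ba≈1 : b * a ≈ 1#
    ba≈1 = trans (*-comm b a) ab≈1
    to : b * x ≈ y → x ≈ a * y
    to bx≈y = begin
      x             ≈⟨ *-identityˡ x ⟨
      1# * x        ≈⟨ *-congʳ ab≈1 ⟨
      (a * b) * x   ≈⟨ *-assoc a b x ⟩
      a * (b * x)   ≈⟨ *-congˡ bx≈y ⟩
      a * y         ∎
    from : x ≈ a * y → b * x ≈ y
    from x≈ay = begin
      b * x         ≈⟨ *-congˡ x≈ay ⟩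
      b * (a * y)   ≈⟨ *-assoc b a y ⟨
      (b * a) * y   ≈⟨ *-congʳ ba≈1 ⟩
      1# * y        ≈⟨ *-identityˡ y ⟩
      y             ∎

module Sums {c ℓ : Level} (R : CommutativeRing c ℓ) where
  open CommutativeRing R hiding (zero)
  open import Relation.Binary.Reasoning.Setoid setoid
  open import Algebra.Properties.Ring ring using (+-cancelˡ)
  open import Algebra.Properties.CommutativeSemigroup +-commutativeSemigroup
    using () renaming (interchange to +-interchange)

  infix 5 ∑≤
  ∑≤ : ℕ → (ℕ → Carrier) → Carrier
  ∑≤ = sumTo R
  syntax ∑≤ n (λ i → x) = ∑[ i ≤ n ] x

  sumTo-cong : ∀ n {f g : ℕ → Carrier} → (∀ {i} → i ≤ n → f i ≈ g i) → ∑≤ n f ≈ ∑≤ n g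
  sumTo-cong zero    f≈g = f≈g z≤n
  sumTo-cong (suc n) f≈g = +-cong (sumTo-cong n (f≈g ∘ ℕₚ.m≤n⇒m≤1+n)) (f≈g ℕₚ.≤-refl)

  sum1To-cong : ∀ n {f g : ℕ → Carrier} → (∀ i → f i ≈ g i) → sum1To R n f ≈ sum1To R n g
  sum1To-cong zero    f≈g = refl
  sum1To-cong (suc n) f≈g = +-cong (sum1To-cong n f≈g) (f≈g (suc n))

  sumTo-+ : ∀ n (f g : ℕ → Carrier) → ∑[ i ≤ n ] (f i + g i) ≈ ∑≤ n f + ∑≤ n g
  sumTo-+ zero    f g = refl
  sumTo-+ (suc n) f g = trans (+-congʳ (sumTo-+ n f g)) (+-interchange _ _ _ _)

  *-distribˡ-sumTo : ∀ x n (f : ℕ → Carrier) → x * ∑≤ n f ≈ ∑[ i ≤ n ] x * f i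
  *-distribˡ-sumTo x zero    f = refl
  *-distribˡ-sumTo x (suc n) f = trans (distribˡ x _ _) (+-congʳ (*-distribˡ-sumTo x n f))

  sumTo-zero : ∀ n {f : ℕ → Carrier} → (∀ {i} → i ≤ n → f i ≈ 0#) → ∑≤ n f ≈ 0#
  sumTo-zero n f≈0 = trans (sumTo-cong n f≈0) (zeros n)
    where
    zeros : ∀ n → ∑[ i ≤ n ] 0# ≈ 0#
    zeros zero    = refl
    zeros (suc n) = trans (+-identityʳ _) (zeros n)

  sumTo-suc-head : ∀ n (f : ℕ → Carrier) → ∑≤ (suc n) f ≈ f 0 + (∑[ i ≤ n ] f (suc i))
  sumTo-suc-head zero    f = refl
  sumTo-suc-head (suc n) f = trans (+-congʳ (sumTo-suc-head n f)) (+-assoc _ _ _)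

  sumTo≈head+sum1To : ∀ n (f : ℕ → Carrier) → ∑≤ n f ≈ f 0 + sum1To R n f
  sumTo≈head+sum1To zero    f = sym (+-identityʳ _)
  sumTo≈head+sum1To (suc n) f = trans (+-congʳ (sumTo≈head+sum1To n f)) (+-assoc _ _ _)

  sumTo-extend : ∀ {m n} (f : ℕ → Carrier) → n ≤ m → (∀ {k} → n < k → f k ≈ 0#) →
                 ∑≤ m f ≈ ∑≤ n f
  sumTo-extend {n = n} f n≤m tail≈0 = go (ℕₚ.≤⇒≤′ n≤m)
    where
    go : ∀ {m} → n ≤′ m → ∑≤ m f ≈ ∑≤ n f
    go ≤′-refl      = refl
    go (≤′-step n≤m) =
      trans (+-congˡ (tail≈0 (s≤s (ℕₚ.≤′⇒≤ n≤m)))) (trans (+-identityʳ _) (go n≤m))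

  sumTo-last : ∀ n {f : ℕ → Carrier} → (∀ {k} → k < n → f k ≈ 0#) → ∑≤ n f ≈ f n
  sumTo-last zero    _      = refl
  sumTo-last (suc n) init≈0 = trans (+-congʳ (sumTo-zero n (init≈0 ∘ s≤s))) (+-identityˡ _)

  sumTo-comm : ∀ n m (h : ℕ → ℕ → Carrier) →
               ∑[ i ≤ n ] ∑[ j ≤ m ] h i j ≈ ∑[ j ≤ m ] ∑[ i ≤ n ] h i j
  sumTo-comm zero    m h = refl
  sumTo-comm (suc n) m h = trans (+-congʳ (sumTo-comm n m h)) (sym (sumTo-+ m _ _))

  unitriangular-injective : ∀ (a : ℕ → ℕ → Carrier) {u v : ℕ → Carrier} → (∀ n → a n n ≈ 1#) →
    (∀ n → ∑[ r ≤ n ] a n r * u r ≈ ∑[ r ≤ n ] a n r * v r) → ∀ n → u n ≈ v n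
  unitriangular-injective a {u} {v} diag sums≈ n = agree n ℕₚ.≤-refl
    where
    cancel-diagonal : ∀ n → a n n * u n ≈ a n n * v n → u n ≈ v n
    cancel-diagonal n eq = begin
      u n              ≈⟨ *-identityˡ (u n) ⟨
      1# * u n         ≈⟨ *-congʳ (diag n) ⟨
      a n n * u n      ≈⟨ eq ⟩
      a n n * v n      ≈⟨ *-congʳ (diag n) ⟩
      1# * v n         ≈⟨ *-identityˡ (v n) ⟩
      v n              ∎
    agree : ∀ n {r} → r ≤ n → u r ≈ v r
    agree zero    z≤n = cancel-diagonal 0 (sums≈ 0)
    agree (suc n) r≤1+n with ℕₚ.m≤n⇒m<n∨m≡n r≤1+n
    ... | inj₁ (s≤s r≤n) = agree n r≤n
    ... | inj₂ ≡.refl    = cancel-diagonal (suc n)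
      (+-cancelˡ _ _ _ (trans (+-congʳ (sym (sumTo-cong n (*-congˡ ∘ agree n)))) (sums≈ (suc n))))

module PowerSeriesCalculus {c ℓ : Level} (R : CommutativeRing c ℓ) where
  open CommutativeRing R hiding (zero)
  open import Relation.Binary.Reasoning.Setoid setoid
  open import Algebra.Properties.CommutativeSemigroup *-commutativeSemigroup using (x∙yz≈y∙xz; xy∙z≈y∙xz)
  open RingProperties R using (fromℕ-+; fromℕ-*)
  open Sums R

  infix  4 _≋_
  infixl 6 _+ₚ_
  infixl 7 _⊛_ _·ₚ_
  infixr 8 _^_

  _≋_ : PowerSeries R → PowerSeries R → Set ℓ
  _≋_ = _≈ₚ_ R

  _⊛_ : PowerSeries R → PowerSeries R → PowerSeries R
  _⊛_ = _*ₚ_ R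

  _^_ : PowerSeries R → ℕ → PowerSeries R
  _^_ = _^ₚ_ R

  𝟙 : PowerSeries R
  𝟙 = oneₚ R

  0ₚ : PowerSeries R
  0ₚ _ = 0#

  _+ₚ_ : PowerSeries R → PowerSeries R → PowerSeries R
  (F +ₚ G) n = F n + G n

  _·ₚ_ : Carrier → PowerSeries R → PowerSeries R
  (s ·ₚ F) n = s * F n

  ∂ : PowerSeries R → PowerSeries R
  ∂ F n = fromℕ R (suc n) * F (suc n)

  ⊛-cong : ∀ {F F′ G G′} → F ≋ F′ → G ≋ G′ → F ⊛ G ≋ F′ ⊛ G′
  ⊛-cong F≋F′ G≋G′ n = sumTo-cong n (λ _ → *-cong (F≋F′ _) (G≋G′ _))

  ⊛-distribʳ : ∀ F G H → (F +ₚ G) ⊛ H ≋ F ⊛ H +ₚ G ⊛ H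
  ⊛-distribʳ F G H n = trans (sumTo-cong n (λ _ → distribʳ _ _ _)) (sumTo-+ n _ _)

  ⊛-distribˡ : ∀ F G H → F ⊛ (G +ₚ H) ≋ F ⊛ G +ₚ F ⊛ H
  ⊛-distribˡ F G H n = trans (sumTo-cong n (λ _ → distribˡ _ _ _)) (sumTo-+ n _ _)

  ⊛-·ₚ-comm : ∀ F s G → F ⊛ (s ·ₚ G) ≋ s ·ₚ (F ⊛ G)
  ⊛-·ₚ-comm F s G n = trans (sumTo-cong n (λ _ → x∙yz≈y∙xz _ _ _)) (sym (*-distribˡ-sumTo s n _))

  ⊛-zeroʳ : ∀ F → F ⊛ 0ₚ ≋ 0ₚ
  ⊛-zeroʳ F n = sumTo-zero n (λ _ → zeroʳ _)

  ⊛-identityˡ : ∀ G → 𝟙 ⊛ G ≋ G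
  ⊛-identityˡ G zero    = *-identityˡ _
  ⊛-identityˡ G (suc n) = begin
    (𝟙 ⊛ G) (suc n)                              ≈⟨ sumTo-suc-head n _ ⟩
    1# * G (suc n) + (∑[ i ≤ n ] 0# * G (n ∸ i))  ≈⟨ +-cong (*-identityˡ _) (sumTo-zero n (λ _ → zeroˡ _)) ⟩
    G (suc n) + 0#                               ≈⟨ +-identityʳ _ ⟩
    G (suc n)                                    ∎

  ∂-𝟙 : ∂ 𝟙 ≋ 0ₚ
  ∂-𝟙 n = zeroʳ _

  factorial-∂ : ∀ F n → fromℕ R (suc n !) * F (suc n) ≈ fromℕ R (n !) * ∂ F n
  factorial-∂ F n = trans (*-congʳ (fromℕ-* (suc n) (n !))) (xy∙z≈y∙xz _ _ _)

  ∂-⊛ : ∀ F G → ∂ (F ⊛ G) ≋ ∂ F ⊛ G +ₚ F ⊛ ∂ G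
  ∂-⊛ F G n = begin
    fromℕ R (suc n) * ∑≤ (suc n) t                                ≈⟨ *-distribˡ-sumTo _ (suc n) t ⟩
    (∑[ i ≤ suc n ] fromℕ R (suc n) * t i)                         ≈⟨ sumTo-cong (suc n) split ⟩
    (∑[ i ≤ suc n ] (fromℕ R i * t i + fromℕ R (suc n ∸ i) * t i)) ≈⟨ sumTo-+ (suc n) _ _ ⟩
    (∑[ i ≤ suc n ] fromℕ R i * t i)
      + (∑[ i ≤ suc n ] fromℕ R (suc n ∸ i) * t i)                 ≈⟨ +-cong differentiate-F differentiate-G ⟩
    (∂ F ⊛ G) n + (F ⊛ ∂ G) n                                     ∎
    where
    t : ℕ → Carrier
    t i = F i * G (suc n ∸ i)

    split : ∀ {i} → i ≤ suc n → fromℕ R (suc n) * t i ≈ fromℕ R i * t i + fromℕ R (suc n ∸ i) * t i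
    split {i} i≤1+n = begin
      fromℕ R (suc n) * t i                        ≡⟨ ≡.cong (λ m → fromℕ R m * t i) (ℕₚ.m+[n∸m]≡n i≤1+n) ⟨
      fromℕ R (i ℕ.+ (suc n ∸ i)) * t i            ≈⟨ *-congʳ (fromℕ-+ i (suc n ∸ i)) ⟩
      (fromℕ R i + fromℕ R (suc n ∸ i)) * t i      ≈⟨ distribʳ _ _ _ ⟩
      fromℕ R i * t i + fromℕ R (suc n ∸ i) * t i  ∎

    differentiate-F : ∑[ i ≤ suc n ] fromℕ R i * t i ≈ (∂ F ⊛ G) n
    differentiate-F = begin
      (∑[ i ≤ suc n ] fromℕ R i * t i)                  ≈⟨ sumTo-suc-head n _ ⟩
      0# * t 0 + (∑[ i ≤ n ] fromℕ R (suc i) * t (suc i)) ≈⟨ +-congʳ (zeroˡ _) ⟩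
      0# + (∑[ i ≤ n ] fromℕ R (suc i) * t (suc i))      ≈⟨ +-identityˡ _ ⟩
      (∑[ i ≤ n ] fromℕ R (suc i) * t (suc i))           ≈⟨ sumTo-cong n (λ _ → *-assoc _ _ _) ⟨
      (∂ F ⊛ G) n                                       ∎

    shift-factor : ∀ {i} → i ≤ n → fromℕ R (suc n ∸ i) * t i ≈ F i * ∂ G (n ∸ i)
    shift-factor i≤n rewrite ℕₚ.+-∸-assoc 1 i≤n = x∙yz≈y∙xz _ _ _

    differentiate-G : ∑[ i ≤ suc n ] fromℕ R (suc n ∸ i) * t i ≈ (F ⊛ ∂ G) n
    differentiate-G = begin
      (∑[ i ≤ n ] fromℕ R (suc n ∸ i) * t i) + fromℕ R (n ∸ n) * t (suc n)  ≈⟨ +-congˡ last≈0 ⟩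
      (∑[ i ≤ n ] fromℕ R (suc n ∸ i) * t i) + 0#                        ≈⟨ +-identityʳ _ ⟩
      (∑[ i ≤ n ] fromℕ R (suc n ∸ i) * t i)                             ≈⟨ sumTo-cong n shift-factor ⟩
      (F ⊛ ∂ G) n                                                        ∎
      where
      last≈0 : fromℕ R (n ∸ n) * t (suc n) ≈ 0#
      last≈0 rewrite ℕₚ.n∸n≡0 n = zeroˡ _

module StirlingInversion {c ℓ : Level} (R : CommutativeRing c ℓ) where
  open CommutativeRing R hiding (zero)
  open import Relation.Binary.Reasoning.Setoid setoid
  open import Algebra.Properties.Ring ring using (+-identityˡ-unique; +-cancelʳ)
  open import Algebra.Properties.CommutativeSemigroup *-commutativeSemigroup using (x∙yz≈y∙xz)
  open RingProperties R
  open Sums R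

  coeff : ℕ → ℕ → Carrier
  coeff d r = fromℤ R (stirlingCoeff d r)

  surj : ℕ → ℕ → Carrier
  surj n k = fromℕ R (surjections n k)

  coeff-diagonal : ∀ d → coeff d d ≈ 1#
  coeff-diagonal d = trans (reflexive (≡.cong (fromℤ R) (stirlingCoeff-diagonal d))) (+-identityʳ 1#)

  coeff-above : ∀ {d r} → d < r → coeff d r ≈ 0#
  coeff-above d<r = reflexive (≡.cong (fromℤ R) (stirlingCoeff-above d<r))

  coeff-suc-zero : ∀ d → coeff (suc d) 0 ≈ 0#
  coeff-suc-zero d = reflexive (≡.cong (fromℤ R) (stirlingCoeff-suc-zero d))

  coeff-rec-zero : ∀ d → coeff (suc d) 0 + fromℕ R d * coeff d 0 ≈ 0#
  coeff-rec-zero d = trans (sym (fromℤ-+-fromℕ-* (stirlingCoeff (suc d) 0) d (stirlingCoeff d 0)))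
                           (reflexive (≡.cong (fromℤ R) (stirlingCoeff-rec-zero d)))

  coeff-rec-suc : ∀ d r → coeff (suc d) (suc r) + fromℕ R d * coeff d (suc r) ≈ coeff d r
  coeff-rec-suc d r =
    trans (sym (fromℤ-+-fromℕ-* (stirlingCoeff (suc d) (suc r)) d (stirlingCoeff d (suc r))))
          (reflexive (≡.cong (fromℤ R) (stirlingCoeff-rec-suc d r)))

  surj-rec : ∀ n k → surj (suc n) (suc k) ≈ fromℕ R (suc k) * (surj n (suc k) + surj n k)
  surj-rec n k = trans (fromℕ-* (suc k) (surjections n (suc k) ℕ.+ surjections n k))
                       (*-congˡ (fromℕ-+ (surjections n (suc k)) (surjections n k)))

  coeff∙surj : ℕ → ℕ → Carrier
  coeff∙surj d k = ∑[ r ≤ d ] coeff d r * surj r k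

  coeff∙surj-suc : ∀ d k →
    coeff∙surj (suc d) k + fromℕ R d * coeff∙surj d k ≈ ∑[ r ≤ d ] coeff d r * surj (suc r) k
  coeff∙surj-suc d k = begin
    coeff∙surj (suc d) k + fromℕ R d * coeff∙surj d k
      ≈⟨ +-congˡ (*-congˡ pad) ⟩
    coeff∙surj (suc d) k + fromℕ R d * (∑[ r ≤ suc d ] coeff d r * surj r k)
      ≈⟨ +-congˡ (*-distribˡ-sumTo _ (suc d) _) ⟩
    coeff∙surj (suc d) k + (∑[ r ≤ suc d ] fromℕ R d * (coeff d r * surj r k))
      ≈⟨ sumTo-+ (suc d) _ _ ⟨
    (∑[ r ≤ suc d ] (coeff (suc d) r * surj r k + fromℕ R d * (coeff d r * surj r k)))
      ≈⟨ sumTo-cong (suc d) (λ _ → collect) ⟩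
    (∑[ r ≤ suc d ] (coeff (suc d) r + fromℕ R d * coeff d r) * surj r k)
      ≈⟨ sumTo-suc-head d _ ⟩
    (coeff (suc d) 0 + fromℕ R d * coeff d 0) * surj 0 k
      + (∑[ r ≤ d ] (coeff (suc d) (suc r) + fromℕ R d * coeff d (suc r)) * surj (suc r) k)
      ≈⟨ +-cong (trans (*-congʳ (coeff-rec-zero d)) (zeroˡ _))
                (sumTo-cong d (λ _ → *-congʳ (coeff-rec-suc d _))) ⟩
    0# + (∑[ r ≤ d ] coeff d r * surj (suc r) k)
      ≈⟨ +-identityˡ _ ⟩
    (∑[ r ≤ d ] coeff d r * surj (suc r) k) ∎
    where
    pad : coeff∙surj d k ≈ ∑[ r ≤ suc d ] coeff d r * surj r k
    pad = sym (sumTo-extend _ (ℕₚ.n≤1+n d) (λ d<r → trans (*-congʳ (coeff-above d<r)) (zeroˡ _)))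
    collect : ∀ {a b x} → a * x + fromℕ R d * (b * x) ≈ (a + fromℕ R d * b) * x
    collect = sym (trans (distribʳ _ _ _) (+-congˡ (*-assoc _ _ _)))

  coeff∙surj-rec-zero : ∀ d → coeff∙surj (suc d) 0 + fromℕ R d * coeff∙surj d 0 ≈ 0#
  coeff∙surj-rec-zero d = trans (coeff∙surj-suc d 0) (sumTo-zero d (λ _ → zeroʳ _))

  coeff∙surj-rec-suc : ∀ d k → coeff∙surj (suc d) (suc k) + fromℕ R d * coeff∙surj d (suc k)
                                ≈ fromℕ R (suc k) * (coeff∙surj d (suc k) + coeff∙surj d k)
  coeff∙surj-rec-suc d k = begin
    coeff∙surj (suc d) (suc k) + fromℕ R d * coeff∙surj d (suc k)
      ≈⟨ coeff∙surj-suc d (suc k) ⟩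
    (∑[ r ≤ d ] coeff d r * surj (suc r) (suc k))
      ≈⟨ sumTo-cong d (λ _ → expand) ⟩
    (∑[ r ≤ d ] fromℕ R (suc k) * (coeff d r * surj r (suc k) + coeff d r * surj r k))
      ≈⟨ *-distribˡ-sumTo _ d _ ⟨
    fromℕ R (suc k) * (∑[ r ≤ d ] (coeff d r * surj r (suc k) + coeff d r * surj r k))
      ≈⟨ *-congˡ (sumTo-+ d _ _) ⟩
    fromℕ R (suc k) * (coeff∙surj d (suc k) + coeff∙surj d k) ∎
    where
    expand : ∀ {r} → coeff d r * surj (suc r) (suc k)
                     ≈ fromℕ R (suc k) * (coeff d r * surj r (suc k) + coeff d r * surj r k)
    expand {r} = trans (*-congˡ (surj-rec r k)) (trans (x∙yz≈y∙xz _ _ _) (*-congˡ (distribˡ _ _ _)))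

  coeff∙surj-offDiagonal : ∀ d k → k ≢ d → coeff∙surj d k ≈ 0#
  coeff∙surj-offDiagonal zero    zero    0≢0 = ⊥-elim (0≢0 ≡.refl)
  coeff∙surj-offDiagonal zero    (suc k) _   = zeroʳ _
  coeff∙surj-offDiagonal (suc d) zero    _   = +-identityˡ-unique _ _ (begin
    coeff∙surj (suc d) 0 + fromℕ R d * coeff∙surj d 0  ≈⟨ coeff∙surj-rec-zero d ⟩
    0#                                               ≈⟨ multiple≈0 d ⟨
    fromℕ R d * coeff∙surj d 0                        ∎)
    where
    multiple≈0 : ∀ m → fromℕ R m * coeff∙surj m 0 ≈ 0#
    multiple≈0 zero    = zeroˡ _
    multiple≈0 (suc m) = trans (*-congˡ (coeff∙surj-offDiagonal (suc m) 0 (λ ()))) (zeroʳ _)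
  coeff∙surj-offDiagonal (suc d) (suc k) 1+k≢1+d = +-cancelʳ (fromℕ R d * x) _ _ (begin
    coeff∙surj (suc d) (suc k) + fromℕ R d * x  ≈⟨ coeff∙surj-rec-suc d k ⟩
    fromℕ R (suc k) * (x + coeff∙surj d k)
      ≈⟨ *-congˡ (+-congˡ (coeff∙surj-offDiagonal d k (1+k≢1+d ∘ ≡.cong suc))) ⟩
    fromℕ R (suc k) * (x + 0#)                  ≈⟨ *-congˡ (+-identityʳ x) ⟩
    fromℕ R (suc k) * x                         ≈⟨ same-multiple ⟨
    fromℕ R d * x                               ≈⟨ +-identityˡ _ ⟨
    0# + fromℕ R d * x                          ∎)
    where
    x : Carrier
    x = coeff∙surj d (suc k)
    -- Either suc k ≡ d, or x vanishes by induction.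
    same-multiple : fromℕ R d * x ≈ fromℕ R (suc k) * x
    same-multiple with suc k ℕ.≟ d
    ... | yes 1+k≡d = reflexive (≡.cong (λ m → fromℕ R m * x) (≡.sym 1+k≡d))
    ... | no  1+k≢d = trans (multiple≈0 d) (sym (multiple≈0 (suc k)))
      where
      multiple≈0 : ∀ m → fromℕ R m * x ≈ 0#
      multiple≈0 _ = trans (*-congˡ (coeff∙surj-offDiagonal d (suc k) 1+k≢d)) (zeroʳ _)

  coeff∙surj-diagonal : ∀ d → coeff∙surj d d ≈ fromℕ R (d !)
  coeff∙surj-diagonal zero    = trans (*-congʳ (+-identityʳ 1#)) (*-identityˡ _)
  coeff∙surj-diagonal (suc d) = +-cancelʳ (fromℕ R d * x) _ _ (begin
    coeff∙surj (suc d) (suc d) + fromℕ R d * x  ≈⟨ coeff∙surj-rec-suc d d ⟩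
    fromℕ R (suc d) * (x + coeff∙surj d d)      ≈⟨ *-congˡ (+-cong x≈0 (coeff∙surj-diagonal d)) ⟩
    fromℕ R (suc d) * (0# + fromℕ R (d !))      ≈⟨ *-congˡ (+-identityˡ _) ⟩
    fromℕ R (suc d) * fromℕ R (d !)             ≈⟨ fromℕ-* (suc d) (d !) ⟨
    fromℕ R (suc d !)                           ≈⟨ +-identityʳ _ ⟨
    fromℕ R (suc d !) + 0#                      ≈⟨ +-congˡ (trans (*-congˡ x≈0) (zeroʳ _)) ⟨
    fromℕ R (suc d !) + fromℕ R d * x           ∎)
    where
    x : Carrier
    x = coeff∙surj d (suc d)
    x≈0 : x ≈ 0#
    x≈0 = coeff∙surj-offDiagonal d (suc d) ℕₚ.1+n≢n

  surjectionTransform : (ℕ → Carrier) → ℕ → Carrier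
  surjectionTransform g n = ∑[ k ≤ n ] g k * surj n k

  coeff-surjectionTransform : ∀ g n → ∑[ r ≤ n ] coeff n r * surjectionTransform g r ≈ fromℕ R (n !) * g n
  coeff-surjectionTransform g n = begin
    (∑[ r ≤ n ] coeff n r * surjectionTransform g r)
      ≈⟨ sumTo-cong n (λ r≤n → *-congˡ (extend r≤n)) ⟩
    (∑[ r ≤ n ] coeff n r * (∑[ k ≤ n ] g k * surj r k))
      ≈⟨ sumTo-cong n (λ _ → *-distribˡ-sumTo _ n _) ⟩
    (∑[ r ≤ n ] ∑[ k ≤ n ] coeff n r * (g k * surj r k))
      ≈⟨ sumTo-comm n n _ ⟩
    (∑[ k ≤ n ] ∑[ r ≤ n ] coeff n r * (g k * surj r k))
      ≈⟨ sumTo-cong n (λ _ → trans (sumTo-cong n (λ _ → x∙yz≈y∙xz _ _ _))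
                                   (sym (*-distribˡ-sumTo _ n _))) ⟩
    (∑[ k ≤ n ] g k * coeff∙surj n k)
      ≈⟨ sumTo-last n (λ k<n → trans (*-congˡ (coeff∙surj-offDiagonal n _ (ℕₚ.<⇒≢ k<n))) (zeroʳ _)) ⟩
    g n * coeff∙surj n n
      ≈⟨ trans (*-congˡ (coeff∙surj-diagonal n)) (*-comm _ _) ⟩
    fromℕ R (n !) * g n ∎
    where
    extend : ∀ {r} → r ≤ n → surjectionTransform g r ≈ ∑[ k ≤ n ] g k * surj r k
    extend {r} r≤n = sym (sumTo-extend _ r≤n (λ r<k →
      trans (*-congˡ (reflexive (≡.cong (fromℕ R) (surjections-below r<k)))) (zeroʳ _)))

  stirling-inversion : ∀ (g b : ℕ → Carrier) → (∀ n → b n ≈ surjectionTransform g n)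
                             ⇔ (∀ n → ∑[ r ≤ n ] coeff n r * b r ≈ fromℕ R (n !) * g n)
  stirling-inversion g b = mk⇔ to from
    where
    to : (∀ n → b n ≈ surjectionTransform g n) → ∀ n → ∑[ r ≤ n ] coeff n r * b r ≈ fromℕ R (n !) * g n
    to b≈ n = trans (sumTo-cong n (λ {r} _ → *-congˡ (b≈ r))) (coeff-surjectionTransform g n)
    from : (∀ n → ∑[ r ≤ n ] coeff n r * b r ≈ fromℕ R (n !) * g n) → ∀ n → b n ≈ surjectionTransform g n
    from sums = unitriangular-injective coeff coeff-diagonal
      (λ n → trans (sums n) (sym (coeff-surjectionTransform g n)))

module HomomorphismProperties {a ℓa b ℓb : Level} (R : CommutativeRing a ℓa) (S : CommutativeRing b ℓb)
  {f : CommutativeRing.Carrier R → CommutativeRing.Carrier S}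
  (f-hom : RingMorphisms.IsRingHomomorphism (CommutativeRing.rawRing R) (CommutativeRing.rawRing S) f)
  where
  open CommutativeRing S hiding (zero)
  open RingMorphisms.IsRingHomomorphism f-hom using (+-homo; 0#-homo; 1#-homo; -‿homo)

  homo-fromℕ : ∀ n → f (fromℕ R n) ≈ fromℕ S n
  homo-fromℕ zero    = 0#-homo
  homo-fromℕ (suc n) = trans (+-homo _ _) (+-cong 1#-homo (homo-fromℕ n))

  homo-fromℤ : ∀ z → f (fromℤ R z) ≈ fromℤ S z
  homo-fromℤ (+ n)    = homo-fromℕ n
  homo-fromℤ -[1+ n ] = trans (-‿homo _) (-‿cong (homo-fromℕ (suc n)))

  homo-sum1To : ∀ n h → f (sum1To R n h) ≈ sum1To S n (f ∘ h)
  homo-sum1To zero    h = 0#-homo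
  homo-sum1To (suc n) h = trans (+-homo _ _) (+-congʳ (homo-sum1To n h))

module UIntegrality {c ℓ c′ ℓ′ : Level} (D : CommutativeRing c ℓ) (char0 : HasCharacteristicZero D)
                    (Frac : FieldOfFractions D c′ ℓ′) where
  open FieldOfFractions Frac using (K; ι; ι-mono; inv-law)
  open CommutativeRing K hiding (zero)
  private module D = CommutativeRing D
  module S = Setting D char0 Frac
  open import Relation.Binary.Reasoning.Setoid setoid
  open import Algebra.Properties.CommutativeSemigroup *-commutativeSemigroup using (x∙yz≈y∙xz)
  open RingMorphisms.IsRingMonomorphism ι-mono using (isRingHomomorphism; *-homo)
  open HomomorphismProperties D K isRingHomomorphism
  open RingProperties K
  open Sums K
  open PowerSeriesCalculus K
  open StirlingInversion K

  E : PowerSeries K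
  E = S.expMinusOne

  factorial*invFact : ∀ n → fromℕ K (n !) * S.invFact n ≈ 1#
  factorial*invFact n = trans (*-congʳ (sym (homo-fromℕ (n !)))) (inv-law _ _)

  invFact-shift : ∀ n x y → (S.invFact n * x ≈ y ⇔ x ≈ fromℕ K (n !) * y)
  invFact-shift n = *-inverse-shift (factorial*invFact n)

  invFact-unique : ∀ n {y} → fromℕ K (n !) * y ≈ 1# → y ≈ S.invFact n
  invFact-unique n {y} n!y≈1 =
    trans (sym (Equivalence.from (invFact-shift n 1# y) (sym n!y≈1))) (*-identityʳ _)

  suc*invFact-suc : ∀ n → fromℕ K (suc n) * S.invFact (suc n) ≈ S.invFact n
  suc*invFact-suc n = invFact-unique n (trans (sym (factorial-∂ S.invFact n)) (factorial*invFact (suc n)))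

  ∂-expMinusOne : ∂ E ≋ E +ₚ 𝟙
  ∂-expMinusOne zero    = trans (suc*invFact-suc 0) (sym (invFact-unique 0 (begin
    fromℕ K 1 * (0# + 1#)   ≈⟨ *-cong (+-identityʳ 1#) (+-identityˡ 1#) ⟩
    1# * 1#                 ≈⟨ *-identityˡ 1# ⟩
    1#                      ∎)))
  ∂-expMinusOne (suc n) = trans (suc*invFact-suc (suc n)) (sym (+-identityʳ _))

  -- ((e^U − 1)^(k+1))′ = (k+1) (e^U − 1)^k e^U by the product rule alone: ⊛ is never reassociated.
  ∂-E^suc : ∀ k → ∂ (E ^ suc k) ≋ fromℕ K (suc k) ·ₚ (E ^ suc k +ₚ E ^ k)
  E⊛∂E^ : ∀ k → E ⊛ ∂ (E ^ k) ≋ fromℕ K k ·ₚ (E ^ suc k +ₚ E ^ k)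

  ∂-E^suc k n = begin
    ∂ (E ⊛ E ^ k) n                         ≈⟨ ∂-⊛ E (E ^ k) n ⟩
    (∂ E ⊛ E ^ k) n + (E ⊛ ∂ (E ^ k)) n     ≈⟨ +-cong ∂E⊛E^ (E⊛∂E^ k n) ⟩
    s + fromℕ K k * s                       ≈⟨ +-congʳ (*-identityˡ s) ⟨
    1# * s + fromℕ K k * s                  ≈⟨ distribʳ s 1# (fromℕ K k) ⟨
    fromℕ K (suc k) * s                     ∎
    where
    s : Carrier
    s = (E ^ suc k +ₚ E ^ k) n
    ∂E⊛E^ : (∂ E ⊛ E ^ k) n ≈ s
    ∂E⊛E^ = trans (⊛-cong {∂ E} {E +ₚ 𝟙} {E ^ k} {E ^ k} ∂-expMinusOne (λ _ → refl) n)
                  (trans (⊛-distribʳ E 𝟙 (E ^ k) n) (+-congˡ (⊛-identityˡ (E ^ k) n)))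

  E⊛∂E^ zero    n =
    trans (⊛-cong {E} {E} {∂ 𝟙} {0ₚ} (λ _ → refl) ∂-𝟙 n) (trans (⊛-zeroʳ E n) (sym (zeroˡ _)))
  E⊛∂E^ (suc k) n = begin
    (E ⊛ ∂ (E ^ suc k)) n
      ≈⟨ ⊛-cong {E} {E} (λ _ → refl) (∂-E^suc k) n ⟩
    (E ⊛ (fromℕ K (suc k) ·ₚ (E ^ suc k +ₚ E ^ k))) n
      ≈⟨ ⊛-·ₚ-comm E (fromℕ K (suc k)) (E ^ suc k +ₚ E ^ k) n ⟩
    fromℕ K (suc k) * (E ⊛ (E ^ suc k +ₚ E ^ k)) n
      ≈⟨ *-congˡ (⊛-distribˡ E (E ^ suc k) (E ^ k) n) ⟩
    fromℕ K (suc k) * (E ^ suc (suc k) +ₚ E ^ suc k) n ∎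

  factorial*E^ : ∀ n k → fromℕ K (n !) * (E ^ k) n ≈ surj n k
  factorial*E^ zero    zero    = *-identityʳ _
  factorial*E^ zero    (suc k) = trans (*-congˡ (zeroˡ _)) (zeroʳ _)
  factorial*E^ (suc n) zero    = trans (factorial-∂ 𝟙 n) (trans (*-congˡ (∂-𝟙 n)) (zeroʳ _))
  factorial*E^ (suc n) (suc k) = begin
    fromℕ K (suc n !) * (E ^ suc k) (suc n)                      ≈⟨ factorial-∂ (E ^ suc k) n ⟩
    fromℕ K (n !) * ∂ (E ^ suc k) n                             ≈⟨ *-congˡ (∂-E^suc k n) ⟩
    fromℕ K (n !) * (fromℕ K (suc k) * (E ^ suc k +ₚ E ^ k) n)  ≈⟨ x∙yz≈y∙xz _ _ _ ⟩
    fromℕ K (suc k) * (fromℕ K (n !) * (E ^ suc k +ₚ E ^ k) n)  ≈⟨ *-congˡ (distribˡ _ _ _) ⟩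
    fromℕ K (suc k) * (fromℕ K (n !) * (E ^ suc k) n + fromℕ K (n !) * (E ^ k) n)
      ≈⟨ *-congˡ (+-cong (factorial*E^ n (suc k)) (factorial*E^ n k)) ⟩
    fromℕ K (suc k) * (surj n (suc k) + surj n k)                 ≈⟨ surj-rec n k ⟨
    surj (suc n) (suc k)                                          ∎

  factorial*compose : ∀ g n → fromℕ K (n !) * compose K g E n ≈ surjectionTransform g n
  factorial*compose g n = trans (*-distribˡ-sumTo _ n _)
    (sumTo-cong n (λ {k} _ → trans (x∙yz≈y∙xz _ _ _) (*-congˡ (factorial*E^ n k))))

  egf≋compose⇔ : ∀ β (F : PowerSeries D) →
    (S.egf β ≋ compose K (S.ιₚ F) E) ⇔ (∀ n → ι (β n) ≈ surjectionTransform (S.ιₚ F) n)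
  egf≋compose⇔ β F = mk⇔
    (λ egf≋ n → trans (Equivalence.to (coefficient n) (trans (*-comm _ _) (egf≋ n)))
                      (factorial*compose _ n))
    (λ ιβ≈ n → trans (*-comm _ _)
                 (Equivalence.from (coefficient n) (trans (ιβ≈ n) (sym (factorial*compose _ n)))))
    where
    F∘E : PowerSeries K
    F∘E = compose K (S.ιₚ F) E
    coefficient : ∀ n → (S.invFact n * ι (β n) ≈ F∘E n) ⇔ (ι (β n) ≈ fromℕ K (n !) * F∘E n)
    coefficient n = invFact-shift n (ι (β n)) (F∘E n)

  stirlingSum : (ℕ → D.Carrier) → ℕ → D.Carrier
  stirlingSum β d = sum1To D (suc d) (λ r → fromℤ D (stirlingCoeff (suc d) r) D.* β r)

  ι-stirlingSum : ∀ β d → ι (stirlingSum β d) ≈ ∑[ r ≤ suc d ] coeff (suc d) r * ι (β r)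
  ι-stirlingSum β d = begin
    ι (stirlingSum β d)                                      ≈⟨ homo-sum1To (suc d) _ ⟩
    sum1To K (suc d) (λ r → ι (fromℤ D (stirlingCoeff (suc d) r) D.* β r))
      ≈⟨ sum1To-cong (suc d) (λ r → trans (*-homo _ _) (*-congʳ (homo-fromℤ (stirlingCoeff (suc d) r)))) ⟩
    sum1To K (suc d) (λ r → coeff (suc d) r * ι (β r))       ≈⟨ +-identityˡ _ ⟨
    0# + sum1To K (suc d) (λ r → coeff (suc d) r * ι (β r))
      ≈⟨ +-congʳ (trans (*-congʳ (coeff-suc-zero d)) (zeroˡ _)) ⟨
    coeff (suc d) 0 * ι (β 0) + sum1To K (suc d) (λ r → coeff (suc d) r * ι (β r))
      ≈⟨ sumTo≈head+sum1To (suc d) _ ⟨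
    (∑[ r ≤ suc d ] coeff (suc d) r * ι (β r))              ∎

  uIntegral⇒stirlingSums∈D : ∀ β → S.IsUIntegral (S.egf β) →
                             ∀ d → S.InD (S.invFact (suc d) * ι (stirlingSum β d))
  uIntegral⇒stirlingSums∈D β (F , egf≋) d = F (suc d) ,
    sym (Equivalence.from (invFact-shift (suc d) _ _) (trans (ι-stirlingSum β d) (sums (suc d))))
    where
    sums : ∀ n → ∑[ r ≤ n ] coeff n r * ι (β r) ≈ fromℕ K (n !) * ι (F n)
    sums = Equivalence.to (stirling-inversion (S.ιₚ F) (ι ∘ β)) (Equivalence.to (egf≋compose⇔ β F) egf≋)

  stirlingSums∈D⇒uIntegral : ∀ β → (∀ d → S.InD (S.invFact (suc d) * ι (stirlingSum β d))) →
                             S.IsUIntegral (S.egf β)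
  stirlingSums∈D⇒uIntegral β stirlingSums∈D =
    F , Equivalence.from (egf≋compose⇔ β F) (Equivalence.from (stirling-inversion (S.ιₚ F) (ι ∘ β)) sums)
    where
    F : PowerSeries D
    F zero    = β 0
    F (suc d) = proj₁ (stirlingSums∈D d)
    sums : ∀ n → ∑[ r ≤ n ] coeff n r * ι (β r) ≈ fromℕ K (n !) * ι (F n)
    sums zero    = refl
    sums (suc d) = trans (sym (ι-stirlingSum β d))
                         (Equivalence.to (invFact-shift (suc d) _ _) (sym (proj₂ (stirlingSums∈D d))))

mainTheorem3 : ∀ {c ℓ c' ℓ'} (D : CommutativeRing c ℓ) → IsIntegralDomain D →
    (char0 : HasCharacteristicZero D) → (Frac : FieldOfFractions D c' ℓ') →
    (β : ℕ → CommutativeRing.Carrier D) →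
    IsUIntegral D char0 Frac (egf D char0 Frac β) ⇔
      (∀ (d : ℕ) → InD D char0 Frac
        (CommutativeRing._*_ (FieldOfFractions.K Frac) (invFact D char0 Frac (suc d))
          (FieldOfFractions.ι Frac
            (sum1To D (suc d) (λ r →
              CommutativeRing._*_ D (fromℤ D (stirlingCoeff (suc d) r)) (β r))))))
mainTheorem3 D _ char0 Frac β = mk⇔ (uIntegral⇒stirlingSums∈D β) (stirlingSums∈D⇒uIntegral β)
  where open UIntegrality D char0 Frac
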